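{- Let $d\ge 2$ and let $\mathcal{F}\subseteq \binom{\mathbb{N}}{d}$ be a finite family of $d$-sets. If $\mathcal{F}$ is left- and right-compressed, then $\mathcal{F}$ is shifted. In particular, $\mathcal{F}^{(\infty)}$ is always shifted.
   Context: $\mathbb{N}=\{1,2,\dots\}$, $\mathbb{N}_{>k}=\{n\in\mathbb{N}:n>k\}$; $d$-subsets are written $\mathbf{u}=(u_1,\dots,u_d)$ with $u_1<\dots<u_d$. Squashed order: $\mathbf{u}<\mathbf{v}$ if the largest element of the symmetric difference lies in $\mathbf{v}$. A finite $\mathcal{A}\subseteq\binom{\mathbb{N}}{e}$ is compressed if it consists of the $|\mathcal{A}|$ smallest elements of $\binom{\mathbb{N}}{e}$; $\mathcal{A}\subseteq\binom{\mathbb{N}_{>k}}{e}$ is compressed in $\binom{\mathbb{N}_{>k}}{e}$ if it consists of the $|\mathcal{A}|$ smallest elements of $\binom{\mathbb{N}_{>k}}{e}$; $\mathcal{C}(\mathcal{A})$, resp. $\mathcal{C}_{>k}(\mathcal{A})$, denotes that set of smallest elements. For $k\ge1$ let $\widehat{\mathcal{F}}_{1,k}=\{\widehat{\mathbf{u}}\in\binom{\mathbb{N}}{d-1}\mid \{k\}\cup\widehat{\mathbf{u}}\in\mathcal{F},\ k<\min\widehat{\mathbf{u}}\}$ and $\widehat{\mathcal{F}}_{d,k}=\{\widehat{\mathbf{u}}\in\binom{\mathbb{N}}{d-1}\mid \widehat{\mathbf{u}}\cup\{k\}\in\mathcal{F},\ \max\widehat{\mathbf{u}}<k\}$. $\mathcal{F}$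 is left-compressed if every $\widehat{\mathcal{F}}_{1,k}$ is compressed in $\binom{\mathbb{N}_{>k}}{d-1}$, and right-compressed if every $\widehat{\mathcal{F}}_{d,k}$ is compressed in $\binom{\mathbb{N}}{d-1}$. The left partial compression is $\mathcal{C}^{(l)}(\mathcal{F})=\{\{k\}\cup\widehat{\mathbf{u}}\mid k\ge1,\ \widehat{\mathbf{u}}\in\mathcal{C}_{>k}(\widehat{\mathcal{F}}_{1,k})\}$ and the right partial compression is $\mathcal{C}^{(r)}(\mathcal{F})=\{\widehat{\mathbf{u}}\cup\{k\}\mid k\ge1,\ \widehat{\mathbf{u}}\in\mathcal{C}(\widehat{\mathcal{F}}_{d,k})\}$. For a finite $\mathcal{F}$, set $\mathcal{F}^{(0)}=\mathcal{F}$, $\mathcal{F}^{(2k-1)}=\mathcal{C}^{(l)}(\mathcal{F}^{(2k-2)})$, $\mathcal{F}^{(2k)}=\mathcal{C}^{(r)}(\mathcal{F}^{(2k-1)})$ for $k\ge1$; this sequence is eventually constant, and $\mathcal{F}^{(\infty)}$ denotes its eventual value. Borel order: $\mathbf{v}\le_B\mathbf{u}$ if $v_i\le u_i$ for all $i$; $\mathcal{F}$ is shifted if $\mathbf{v}\in\mathcal{F}$ whenever $\mathbf{v}\le_B\mathbf{u}$ for some $\mathbf{u}\in\mathcal{F}$. -}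

module Defs where

open import Data.Bool using (Bool; true; false; not; _∧_; _∨_; if_then_else_)
open import Data.Nat using (ℕ; zero; suc; _+_; _∸_; _⊔_; _≤_; _<_; _≡ᵇ_; _<ᵇ_; _≤ᵇ_)
open import Data.Maybe using (Maybe; just; nothing)
import Data.Maybe as Maybe
open import Data.Product using (_×_; _,_)
open import Data.List using (List; []; _∷_; _++_; [_]; map; length; foldr; filterᵇ; mapMaybe; applyUpTo; concatMap)
open import Data.Bool.ListAction using (any; all)
open import Data.List.Relation.Unary.All using (All)
open import Data.List.Relation.Unary.Linked using (Linked)
open import Data.List.Relation.Unary.Unique.Propositional using (Unique)
open import Data.List.Relation.Binary.Pointwise using (Pointwise)
open import Data.List.Membership.Propositional using (_∈_)
open import Function.Bundles using (_⇔_)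
open import Relation.Binary.PropositionalEquality using (_≡_)

-- A finite set of naturals is represented by the strictly increasing list of
-- its elements; a family of sets by a duplicate-free list of such lists.

-- u is an e-subset of ℕ_{>k}  (k = 0 gives e-subsets of ℕ = {1,2,...})
IsSetGT : ℕ → ℕ → List ℕ → Set
IsSetGT k e u = length u ≡ e × Linked _<_ u × All (k <_) u

_∈ᵇ_ : ℕ → List ℕ → Bool
x ∈ᵇ u = any (x ≡ᵇ_) u

-- squashed (colex) order:  u <S v  iff the largest element of the symmetric
-- difference of u and v lies in v, i.e. there is x ∈ v \ u such that every
-- element of u \ v is < x and every element of v \ u is ≤ x.
_<Sᵇ_ : List ℕ → List ℕ → Bool
u <Sᵇ v = any (λ x → not (x ∈ᵇ u)
                     ∧ all (λ y → (y ∈ᵇ v) ∨ (y <ᵇ x)) u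
                     ∧ all (λ y → (y ∈ᵇ u) ∨ (y ≤ᵇ x)) v) v

interval : ℕ → ℕ → List ℕ
interval lo n = applyUpTo (lo +_) n

choose : ℕ → List ℕ → List (List ℕ)
choose zero xs = [ [] ]
choose (suc e) [] = []
choose (suc e) (x ∷ xs) = map (x ∷_) (choose e xs) ++ choose (suc e) xs

maxL : List ℕ → ℕ
maxL = foldr _⊔_ 0

-- number of elements of binom(ℕ_{>k}, e) smaller than v in the squashed order.
-- (Every w <S v satisfies max w ≤ max v, so it suffices to enumerate the
--  e-subsets of {k+1, ..., max v}.)
rankGT : ℕ → ℕ → List ℕ → ℕ
rankGT k e v = length (filterᵇ (λ w → w <Sᵇ v) (choose e (interval (suc k) (maxL v ∸ k))))

-- A ⊆ binom(ℕ_{>k}, e) is compressed in binom(ℕ_{>k}, e): it consists of the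
-- |A| smallest elements of binom(ℕ_{>k}, e).
CompressedGT : ℕ → ℕ → List (List ℕ) → Set
CompressedGT k e A =
  All (IsSetGT k e) A × Unique A ×
  (∀ v → IsSetGT k e v → (v ∈ A ⇔ rankGT k e v < length A))

-- C_{>k}(A): the |A| smallest elements of binom(ℕ_{>k}, e)
-- (they all lie in {k+1, ..., k+e+|A|}).
CGT : ℕ → ℕ → List (List ℕ) → List (List ℕ)
CGT k e A = filterᵇ (λ v → rankGT k e v <ᵇ length A) (choose e (interval (suc k) (e + length A)))

lastSplit : List ℕ → Maybe (List ℕ × ℕ)
lastSplit [] = nothing
lastSplit (x ∷ []) = just ([] , x)
lastSplit (x ∷ y ∷ ys) = Maybe.map (λ { (u , z) → (x ∷ u , z) }) (lastSplit (y ∷ ys))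

-- \hat F_{1,k} = { û | {k} ∪ û ∈ F, k < min û }
slice1 : ℕ → List (List ℕ) → List (List ℕ)
slice1 k F = mapMaybe f F
  where
  f : List ℕ → Maybe (List ℕ)
  f [] = nothing
  f (x ∷ u) = if x ≡ᵇ k then just u else nothing

-- \hat F_{d,k} = { û | û ∪ {k} ∈ F, max û < k }
sliceD : ℕ → List (List ℕ) → List (List ℕ)
sliceD k F = mapMaybe f F
  where
  g : Maybe (List ℕ × ℕ) → Maybe (List ℕ)
  g nothing = nothing
  g (just (u , z)) = if z ≡ᵇ k then just u else nothing
  f : List ℕ → Maybe (List ℕ)
  f u = g (lastSplit u)

IsDSet : ℕ → List ℕ → Set
IsDSet d = IsSetGT 0 d

FiniteFamily : ℕ → List (List ℕ) → Set
FiniteFamily d F = All (IsDSet d) F × Unique F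

LeftCompressed : ℕ → List (List ℕ) → Set
LeftCompressed d F = ∀ k → 1 ≤ k → CompressedGT k (d ∸ 1) (slice1 k F)

RightCompressed : ℕ → List (List ℕ) → Set
RightCompressed d F = ∀ k → 1 ≤ k → CompressedGT 0 (d ∸ 1) (sliceD k F)

_≤B_ : List ℕ → List ℕ → Set
v ≤B u = Pointwise _≤_ v u

Shifted : ℕ → List (List ℕ) → Set
Shifted d F = ∀ u v → u ∈ F → IsDSet d v → v ≤B u → v ∈ F

-- largest element occurring in the family (only k ≤ this can have nonempty slices)
maxF : List (List ℕ) → ℕ
maxF F = foldr (λ u m → maxL u ⊔ m) 0 F

CL : ℕ → List (List ℕ) → List (List ℕ)
CL d F = concatMap (λ k → map (k ∷_) (CGT k (d ∸ 1) (slice1 k F))) (interval 1 (maxF F))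

CR : ℕ → List (List ℕ) → List (List ℕ)
CR d F = concatMap (λ k → map (_++ [ k ]) (CGT 0 (d ∸ 1) (sliceD k F))) (interval 1 (maxF F))

isEven : ℕ → Bool
isEven zero = true
isEven (suc n) = not (isEven n)

iterC : ℕ → List (List ℕ) → ℕ → List (List ℕ)
iterC d F zero = F
iterC d F (suc n) = if isEven n then CL d (iterC d F n) else CR d (iterC d F n)

_≈F_ : List (List ℕ) → List (List ℕ) → Set
F ≈F G = ∀ u → (u ∈ F ⇔ u ∈ G)

module Submission where

-- Lowering a set in the Borel order lowers it in the squashed order
-- (≤B⇒≼), so its squashed rank can only drop (rank-mono).  Hence compressed
-- families and compressions C_{>k}(A) are Borel-down-closed
-- (compressed⇒downClosed, CGT-downClosed).  Down-closed slices \hat F_{1,h}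
-- make a family left-stable (the part after the first element may be lowered)
-- and down-closed slices \hat F_{d,k} make it right-stable (the part before the
-- last element may be lowered).  A stable family of d-sets, d ≥ 2, is shifted
-- (stable⇒shifted): first lower all but the last coordinate, then lower the
-- last one while keeping the first.  Compressed families are stable through
-- their slices; the limit F^{(∞)} is at once some C^{(l)}(X) and some
-- C^{(r)}(Y), whose slices are compressions, so it is stable as well.

open import Defs
open import Data.Bool using (Bool; true; false; not; _∧_; _∨_; T; T?; if_then_else_)
open import Data.Bool.ListAction using (all)
open import Data.Bool.Properties using (T-∧; T-∨)
open import Data.Nat using (ℕ; zero; suc; _+_; _∸_; _≤_; _<_; _≡ᵇ_; _<ᵇ_; _≤ᵇ_; z≤n; s≤s)
open import Data.Nat.Properties
open import Data.Product using (∃; ∃₂; _×_; _,_; proj₁; proj₂)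
open import Data.Sum using (_⊎_; inj₁; inj₂; [_,_]′) renaming (map to ⊎-map)
open import Data.Empty using (⊥-elim)
open import Data.List using (List; []; _∷_; [_]; _∷ʳ_; map; length; applyUpTo; mapMaybe; concatMap; initLast; _∷ʳ′_)
open import Data.List.Properties using (length-++; ∷ʳ-injective)
open import Data.Maybe using (Maybe; just; nothing)
open import Data.List.Relation.Unary.Any as Any using (here; there)
open import Data.List.Relation.Unary.Any.Properties using (any⁺; any⁻)
open import Data.List.Relation.Unary.All as All using (All; []; _∷_)
open import Data.List.Relation.Unary.All.Properties using (all⁺; all⁻; ++⁻ˡ)
open import Data.List.Membership.Propositional using (_∈_; _∉_; find; lose)
open import Data.List.Relation.Unary.Linked as Linked using (Linked)
open import Data.List.Relation.Unary.Linked.Properties using (Linked⇒All; Linked⇒AllPairs; AllPairs⇒Linked; applyUpTo⁺₂)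
open import Data.List.Relation.Unary.AllPairs as AllPairs using (AllPairs; []; _∷_)
open import Data.List.Relation.Binary.Pointwise as Pointwise using (Pointwise; foldr⁺) renaming ([] to P[]; _∷_ to _P∷_)
open import Data.List.Relation.Binary.Sublist.Propositional using (_⊆_; minimum; ⊆-refl)
  renaming ([] to done; _∷ʳ_ to skip; _∷_ to keep)
open import Data.List.Relation.Binary.Sublist.Propositional.Properties using (length-mono-≤; filter⁺; ++⁺; ++⁺ˡ; ++⁺ʳ; All-resp-⊆)
  renaming (map⁺ to ⊆-map⁺)
open import Data.List.Membership.Propositional.Properties
  using (∈-++⁺ˡ; ∈-++⁺ʳ; ∈-++⁻; ∈-map⁺; ∈-map⁻; ∈-applyUpTo⁺; ∈-applyUpTo⁻; ∈-filter⁺; ∈-filter⁻; ∈-concatMap⁺; ∈-concatMap⁻)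
open import Function using (_∘_; id)
open import Function.Bundles using (_⇔_; mk⇔; Equivalence)
import Function.Properties.Equivalence as ⇔
open import Relation.Nullary using (¬_; yes; no)
open import Relation.Binary.Definitions using (tri<; tri≈; tri>)
open import Relation.Binary.PropositionalEquality using (_≡_; refl; sym; trans; cong; subst)

open Equivalence using (to; from)

record _≺_ (w v : List ℕ) : Set where
  field
    top       : ℕ
    top∈v     : top ∈ v
    top∉w     : top ∉ w
    w-below   : ∀ y → y ∈ w → y ∈ v ⊎ y < top
    v-below   : ∀ y → y ∈ v → y ∈ w ⊎ y ≤ top

∈ᵇ⇔∈ : ∀ x u → T (x ∈ᵇ u) ⇔ x ∈ u
∈ᵇ⇔∈ x u = mk⇔ (Any.map (≡ᵇ⇒≡ x _) ∘ any⁻ _ u) (any⁺ _ ∘ Any.map λ { refl → ≡⇒≡ᵇ x x refl })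

T-not⇔¬ : ∀ b → T (not b) ⇔ (¬ T b)
T-not⇔¬ true = mk⇔ (λ ()) (λ f → f _)
T-not⇔¬ false = mk⇔ (λ _ ()) (λ _ → _)

∈-or-below : (v : List ℕ) (_R_ : ℕ → ℕ → Set) (_Rᵇ_ : ℕ → ℕ → Bool) → (∀ y x → T (y Rᵇ x) ⇔ y R x) →
             ∀ y x → T ((y ∈ᵇ v) ∨ (y Rᵇ x)) ⇔ (y ∈ v ⊎ y R x)
∈-or-below v _R_ _Rᵇ_ reflect y x =
  mk⇔ (⊎-map (to (∈ᵇ⇔∈ y v)) (to (reflect y x)) ∘ to T-∨)
      (from T-∨ ∘ ⊎-map (from (∈ᵇ⇔∈ y v)) (from (reflect y x)))

all⇔∀∈ : (p : ℕ → Bool) (Q : ℕ → Set) → (∀ y → T (p y) ⇔ Q y) →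
         ∀ xs → T (all p xs) ⇔ (∀ y → y ∈ xs → Q y)
all⇔∀∈ p Q reflect xs =
  mk⇔ (λ t y y∈xs → to (reflect y) (All.lookup (all⁺ p xs t) y∈xs))
      (λ f → all⁻ p (All.tabulate (λ {y} y∈xs → from (reflect y) (f y y∈xs))))

<Sᵇ⇔≺ : ∀ w v → T (w <Sᵇ v) ⇔ w ≺ v
<Sᵇ⇔≺ w v = mk⇔ decode encode
  where
  IsTop : ℕ → Set
  IsTop x = x ∉ w × (∀ y → y ∈ w → y ∈ v ⊎ y < x) × (∀ y → y ∈ v → y ∈ w ⊎ y ≤ x)

  isTop⇔ : ∀ x → T (not (x ∈ᵇ w) ∧ all (λ y → (y ∈ᵇ v) ∨ (y <ᵇ x)) w
                                 ∧ all (λ y → (y ∈ᵇ w) ∨ (y ≤ᵇ x)) v) ⇔ IsTop x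
  isTop⇔ x = mk⇔
    (λ t → let t₁ , t₂₃ = to T-∧ t ; t₂ , t₃ = to T-∧ t₂₃ in
      (λ x∈w → to (T-not⇔¬ _) t₁ (from (∈ᵇ⇔∈ x w) x∈w)) , to (below-w x) t₂ , to (below-v x) t₃)
    (λ { (x∉w , bw , bv) → from T-∧ (from (T-not⇔¬ _) (x∉w ∘ to (∈ᵇ⇔∈ x w)) ,
                                     from T-∧ (from (below-w x) bw , from (below-v x) bv)) })
    where
    below-w : ∀ x → T (all (λ y → (y ∈ᵇ v) ∨ (y <ᵇ x)) w) ⇔ (∀ y → y ∈ w → y ∈ v ⊎ y < x)
    below-w x = all⇔∀∈ _ _ (λ y → ∈-or-below v _<_ _<ᵇ_ (λ y x → mk⇔ (<ᵇ⇒< y x) <⇒<ᵇ) y x) w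
    below-v : ∀ x → T (all (λ y → (y ∈ᵇ w) ∨ (y ≤ᵇ x)) v) ⇔ (∀ y → y ∈ v → y ∈ w ⊎ y ≤ x)
    below-v x = all⇔∀∈ _ _ (λ y → ∈-or-below w _≤_ _≤ᵇ_ (λ y x → mk⇔ (≤ᵇ⇒≤ y x) ≤⇒≤ᵇ) y x) v

  decode : T (w <Sᵇ v) → w ≺ v
  decode t with find (any⁻ _ v t)
  ... | x , x∈v , px with to (isTop⇔ x) px
  ... | x∉w , bw , bv = record { top = x ; top∈v = x∈v ; top∉w = x∉w ; w-below = bw ; v-below = bv }

  encode : w ≺ v → T (w <Sᵇ v)
  encode w≺v = any⁺ _ (lose top∈v (from (isTop⇔ top) (top∉w , w-below , v-below)))
    where open _≺_ w≺v

-- _≺_ is transitive: the new top is the larger of the two tops.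
≺-trans : ∀ {u v w} → u ≺ v → v ≺ w → u ≺ w
≺-trans p q with <-cmp (top p) (top q)
  where open _≺_
... | tri≈ _ refl _ = ⊥-elim (top∉w q (top∈v p))
  where open _≺_
... | tri< x<z _ _ = record
  { top = top q ; top∈v = top∈v q
  ; top∉w = λ z∈u → [ top∉w q , (λ z<x → <-asym z<x x<z) ]′ (w-below p _ z∈u)
  ; w-below = λ y y∈u → [ w-below q y , (λ y<x → inj₂ (<-trans y<x x<z)) ]′ (w-below p y y∈u)
  ; v-below = λ y y∈w → [ (λ y∈v → ⊎-map id (λ y≤x → ≤-trans y≤x (<⇒≤ x<z)) (v-below p y y∈v)) , inj₂ ]′
                          (v-below q y y∈w) }
  where open _≺_
... | tri> _ _ z<x = record
  { top = top p
  ; top∈v = [ id , (λ x<z → ⊥-elim (<-asym x<z z<x)) ]′ (w-below q _ (top∈v p))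
  ; top∉w = top∉w p
  ; w-below = λ y y∈u → [ (λ y∈v → ⊎-map id (λ y<z → <-trans y<z z<x) (w-below q y y∈v)) , inj₂ ]′
                          (w-below p y y∈u)
  ; v-below = λ y y∈w → [ v-below p y , (λ y≤z → inj₂ (≤-trans y≤z (<⇒≤ z<x))) ]′ (v-below q y y∈w) }
  where open _≺_

sorted-head : ∀ {x xs} → Linked _<_ (x ∷ xs) → All (x <_) xs
sorted-head = AllPairs.head ∘ Linked⇒AllPairs <-trans

≺-∷ : ∀ {a b a' b'} → (p : a' ≺ b') → a < _≺_.top p → b ≤ _≺_.top p → (a ∷ a') ≺ (b ∷ b')
≺-∷ {a} {b} p a<x b≤x = record
  { top = top ; top∈v = there top∈v
  ; top∉w = λ { (here refl) → <-irrefl refl a<x ; (there x∈a') → top∉w x∈a' }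
  ; w-below = λ { _ (here refl) → inj₂ a<x ; y (there y∈a') → ⊎-map there id (w-below y y∈a') }
  ; v-below = λ { _ (here refl) → inj₂ b≤x ; y (there y∈b') → ⊎-map there id (v-below y y∈b') } }
  where open _≺_ p

≺-head : ∀ {a b t} → a < b → All (b <_) t → (a ∷ t) ≺ (b ∷ t)
≺-head {a} {b} a<b b<t = record
  { top = b ; top∈v = here refl
  ; top∉w = λ { (here refl) → <-irrefl refl a<b ; (there b∈t) → <-irrefl refl (All.lookup b<t b∈t) }
  ; w-below = λ { _ (here refl) → inj₂ a<b ; _ (there y∈t) → inj₁ (there y∈t) }
  ; v-below = λ { _ (here refl) → inj₂ ≤-refl ; _ (there y∈t) → inj₁ (there y∈t) } }

≤B⇒≼ : ∀ {a b} → Linked _<_ a → Linked _<_ b → a ≤B b → a ≡ b ⊎ a ≺ b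
≤B⇒≼ _ _ P[] = inj₁ refl
≤B⇒≼ {a ∷ a'} {b ∷ b'} sa sb (a≤b P∷ a'≤b') with ≤B⇒≼ (Linked.tail sa) (Linked.tail sb) a'≤b'
... | inj₂ p = inj₂ (≺-∷ p (≤-<-trans a≤b b<x) (<⇒≤ b<x))
  where
  b<x : b < _≺_.top p
  b<x = All.lookup (sorted-head sb) (_≺_.top∈v p)
... | inj₁ refl with m≤n⇒m<n∨m≡n a≤b
...   | inj₁ a<b = inj₂ (≺-head a<b (sorted-head sb))
...   | inj₂ refl = inj₁ refl

<Sᵇ-mono : ∀ {a b} w → a ≡ b ⊎ a ≺ b → T (w <Sᵇ a) → T (w <Sᵇ b)
<Sᵇ-mono w (inj₁ refl) t = t
<Sᵇ-mono {a} {b} w (inj₂ a≺b) t = from (<Sᵇ⇔≺ w b) (≺-trans (to (<Sᵇ⇔≺ w a) t) a≺b)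

∈-tail : ∀ {x y xs} → x < y → y ∈ x ∷ xs → y ∈ xs
∈-tail x<y (here refl) = ⊥-elim (<-irrefl refl x<y)
∈-tail _ (there y∈xs) = y∈xs

sorted-⊆ : ∀ {a xs} → Linked _<_ a → Linked _<_ xs → (∀ y → y ∈ a → y ∈ xs) → a ⊆ xs
sorted-⊆ {[]} {xs} _ _ _ = minimum xs
sorted-⊆ {a ∷ a'} {[]} _ _ a⊆xs with a⊆xs a (here refl)
... | ()
sorted-⊆ {a ∷ a'} {x ∷ xs} sa sxs a⊆xs with a ≟ x
... | yes refl = keep refl (sorted-⊆ (Linked.tail sa) (Linked.tail sxs)
                   λ y y∈a' → ∈-tail (All.lookup (sorted-head sa) y∈a') (a⊆xs y (there y∈a')))
... | no a≢x = skip x (sorted-⊆ sa (Linked.tail sxs)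
                   λ y y∈a → ∈-tail (All.lookup (Linked⇒All <-trans x<a sa) y∈a) (a⊆xs y y∈a))
  where
  x<a : x < a
  x<a with a⊆xs a (here refl)
  ... | here a≡x = ⊥-elim (a≢x a≡x)
  ... | there a∈xs = All.lookup (sorted-head sxs) a∈xs

⊆-sorted : ∀ {w xs} → w ⊆ xs → Linked _<_ xs → Linked _<_ w
⊆-sorted w⊆xs = AllPairs⇒Linked ∘ pairs w⊆xs ∘ Linked⇒AllPairs <-trans
  where
  pairs : ∀ {w xs} → w ⊆ xs → AllPairs _<_ xs → AllPairs _<_ w
  pairs done [] = []
  pairs (skip _ w⊆xs) (_ ∷ ps) = pairs w⊆xs ps
  pairs (keep refl w⊆xs) (x<xs ∷ ps) = All-resp-⊆ w⊆xs x<xs ∷ pairs w⊆xs ps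

interval-sorted : ∀ lo n → Linked _<_ (interval lo n)
interval-sorted lo n = applyUpTo⁺₂ (lo +_) n (λ i → +-monoʳ-< lo (n<1+n i))

∈-interval⁺ : ∀ {lo n y} → lo ≤ y → y < lo + n → y ∈ interval lo n
∈-interval⁺ {lo} {n} {y} lo≤y y<lo+n =
  subst (_∈ interval lo n) (m+[n∸m]≡n lo≤y)
        (∈-applyUpTo⁺ (lo +_) (+-cancelˡ-< lo _ _ (subst (_< lo + n) (sym (m+[n∸m]≡n lo≤y)) y<lo+n)))

∈-interval⁻ : ∀ {lo n y} → y ∈ interval lo n → y < lo + n
∈-interval⁻ {lo} y∈ with ∈-applyUpTo⁻ (lo +_) y∈
... | i , i<n , refl = +-monoʳ-< lo i<n

interval-⊆ : ∀ lo {m n} → m ≤ n → interval lo m ⊆ interval lo n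
interval-⊆ lo m≤n = go (lo +_) m≤n
  where
  go : ∀ (f : ℕ → ℕ) {m n} → m ≤ n → applyUpTo f m ⊆ applyUpTo f n
  go f {n = n} z≤n = minimum (applyUpTo f n)
  go f (s≤s m≤n) = keep refl (go (f ∘ suc) m≤n)

choose-sound : ∀ e xs {w} → w ∈ choose e xs → w ⊆ xs
choose-sound zero xs (here refl) = minimum xs
choose-sound (suc e) (x ∷ xs) w∈ with ∈-++⁻ (map (x ∷_) (choose e xs)) w∈
... | inj₂ w∈rest = skip x (choose-sound (suc e) xs w∈rest)
... | inj₁ w∈cons with ∈-map⁻ (x ∷_) w∈cons
...   | w' , w'∈ , refl = keep refl (choose-sound e xs w'∈)

choose-complete : ∀ {w xs} → w ⊆ xs → w ∈ choose (length w) xs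
choose-complete {[]} _ = here refl
choose-complete {x ∷ w} (skip y w⊆ys) = ∈-++⁺ʳ (map (y ∷_) (choose (length w) _)) (choose-complete w⊆ys)
choose-complete {x ∷ w} (keep refl w⊆xs) = ∈-++⁺ˡ (∈-map⁺ (x ∷_) (choose-complete w⊆xs))

choose-mono : ∀ e {xs ys} → xs ⊆ ys → choose e xs ⊆ choose e ys
choose-mono zero _ = ⊆-refl
choose-mono (suc e) done = done
choose-mono (suc e) (skip y xs⊆ys) = ++⁺ˡ (map (y ∷_) (choose e _)) (choose-mono (suc e) xs⊆ys)
choose-mono (suc e) (keep {x = x} refl xs⊆ys) = ++⁺ (⊆-map⁺ (x ∷_) (choose-mono e xs⊆ys)) (choose-mono (suc e) xs⊆ys)

maxL-mono : ∀ {a b} → a ≤B b → maxL a ≤ maxL b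
maxL-mono = foldr⁺ ⊔-mono-≤ z≤n

rank-mono : ∀ k e {a b} → Linked _<_ a → Linked _<_ b → a ≤B b → rankGT k e a ≤ rankGT k e b
rank-mono k e {a} {b} sa sb a≤b =
  length-mono-≤ (filter⁺ (T? ∘ (_<Sᵇ a)) (T? ∘ (_<Sᵇ b)) (λ { {w} refl → <Sᵇ-mono w (≤B⇒≼ sa sb a≤b) })
                  (choose-mono e (interval-⊆ (suc k) (∸-monoˡ-≤ k (maxL-mono a≤b)))))

DownClosed : ℕ → ℕ → List (List ℕ) → Set
DownClosed k e A = ∀ {a b} → b ∈ A → IsSetGT k e a → a ≤B b → a ∈ A

-- Compressed families are down-closed, since the rank only drops along ≤B.
compressed⇒downClosed : ∀ {k e A} → CompressedGT k e A → DownClosed k e A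
compressed⇒downClosed {k} {e} (sets , _ , ∈⇔rank<) {a} {b} b∈A sa a≤b =
  from (∈⇔rank< a sa) (≤-<-trans (rank-mono k e (proj₁ (proj₂ sa)) (proj₁ (proj₂ sb)) a≤b) (to (∈⇔rank< b sb) b∈A))
  where
  sb : IsSetGT k e b
  sb = All.lookup sets b∈A

≤B-bounded : ∀ {B a b} → a ≤B b → All (_< B) b → All (_< B) a
≤B-bounded P[] [] = []
≤B-bounded (a≤b P∷ a'≤b') (b<B ∷ b'<B) = ≤-<-trans a≤b b<B ∷ ≤B-bounded a'≤b' b'<B

-- The compression C_{>k}(A) is down-closed: a lowered set stays in the
-- enumerated interval and has smaller rank.
CGT-downClosed : ∀ k e A → DownClosed k e (CGT k e A)
CGT-downClosed k e A {a} {b} b∈C (len-a , sorted-a , above-a) a≤b =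
  ∈-filter⁺ (T? ∘ small) (subst (λ n → a ∈ choose n I) len-a (choose-complete a⊆I))
            (<⇒<ᵇ (≤-<-trans (rank-mono k e sorted-a sorted-b a≤b) (<ᵇ⇒< (rankGT k e b) (length A) small-b)))
  where
  I : List ℕ
  I = interval (suc k) (e + length A)
  small : List ℕ → Bool
  small v = rankGT k e v <ᵇ length A
  b∈choose : b ∈ choose e I
  b∈choose = proj₁ (∈-filter⁻ (T? ∘ small) {xs = choose e I} b∈C)
  small-b : T (small b)
  small-b = proj₂ (∈-filter⁻ (T? ∘ small) {xs = choose e I} b∈C)
  b⊆I : b ⊆ I
  b⊆I = choose-sound e I b∈choose
  sorted-b : Linked _<_ b
  sorted-b = ⊆-sorted b⊆I (interval-sorted (suc k) (e + length A))
  a⊆I : a ⊆ I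
  a⊆I = sorted-⊆ sorted-a (interval-sorted (suc k) (e + length A))
          λ y y∈a → ∈-interval⁺ (All.lookup above-a y∈a)
                      (All.lookup (≤B-bounded a≤b (All-resp-⊆ b⊆I (All.tabulate ∈-interval⁻))) y∈a)

∈-mapMaybe⁺ : ∀ {A B : Set} (f : A → Maybe B) {xs u y} → u ∈ xs → f u ≡ just y → y ∈ mapMaybe f xs
∈-mapMaybe⁺ f {u ∷ xs} (here refl) fu≡y rewrite fu≡y = here refl
∈-mapMaybe⁺ f {x ∷ xs} (there u∈xs) fu≡y with f x
... | just _ = there (∈-mapMaybe⁺ f u∈xs fu≡y)
... | nothing = ∈-mapMaybe⁺ f u∈xs fu≡y

∈-mapMaybe⁻ : ∀ {A B : Set} (f : A → Maybe B) {xs y} → y ∈ mapMaybe f xs → ∃ λ u → u ∈ xs × f u ≡ just y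
∈-mapMaybe⁻ f {x ∷ xs} y∈ with f x in fx
∈-mapMaybe⁻ f {x ∷ xs} (here refl) | just _ = x , here refl , fx
∈-mapMaybe⁻ f {x ∷ xs} (there y∈) | just _ = let u , u∈xs , fu = ∈-mapMaybe⁻ f y∈ in u , there u∈xs , fu
∈-mapMaybe⁻ f {x ∷ xs} y∈ | nothing = let u , u∈xs , fu = ∈-mapMaybe⁻ f y∈ in u , there u∈xs , fu

if-just⁺ : ∀ {A : Set} {b} {a : A} → T b → (if b then just a else nothing) ≡ just a
if-just⁺ {b = true} _ = refl

if-just⁻ : ∀ {A : Set} b {a r : A} → (if b then just a else nothing) ≡ just r → T b × a ≡ r
if-just⁻ true refl = _ , refl

lastSplit-∷ʳ : ∀ u k → lastSplit (u ∷ʳ k) ≡ just (u , k)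
lastSplit-∷ʳ [] k = refl
lastSplit-∷ʳ (x ∷ []) k = refl
lastSplit-∷ʳ (x ∷ y ∷ u) k rewrite lastSplit-∷ʳ (y ∷ u) k = refl

lastSplit-sound : ∀ u {v z} → lastSplit u ≡ just (v , z) → u ≡ v ∷ʳ z
lastSplit-sound (x ∷ []) refl = refl
lastSplit-sound (x ∷ y ∷ u) eq with lastSplit (y ∷ u) in split
lastSplit-sound (x ∷ y ∷ u) refl | just (v , z) = cong (x ∷_) (lastSplit-sound (y ∷ u) split)

slice1⁺ : ∀ {k F r} → (k ∷ r) ∈ F → r ∈ slice1 k F
slice1⁺ {k} k∷r∈F = ∈-mapMaybe⁺ _ k∷r∈F (if-just⁺ (≡⇒≡ᵇ k k refl))

slice1⁻ : ∀ {k F r} → r ∈ slice1 k F → (k ∷ r) ∈ F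
slice1⁻ {k} {F} r∈ with ∈-mapMaybe⁻ {A = List ℕ} _ {xs = F} r∈
... | x ∷ u , u∈F , select with if-just⁻ (x ≡ᵇ k) select
...   | x≡ᵇk , refl rewrite ≡ᵇ⇒≡ x k x≡ᵇk = u∈F

-- The selector behind sliceD is local to Defs; naming it through this
-- equation lets us state how it acts on u ∪ {k}.
sliceD-selector : ∀ k F → ∃ λ (select : List ℕ → Maybe (List ℕ)) → sliceD k F ≡ mapMaybe select F
sliceD-selector k F = _ , refl

selectD-∷ʳ : ∀ k F r → proj₁ (sliceD-selector k F) (r ∷ʳ k) ≡ just r
selectD-∷ʳ k F r rewrite lastSplit-∷ʳ r k = if-just⁺ (≡⇒≡ᵇ k k refl)

selectD-sound : ∀ k F u {r} → proj₁ (sliceD-selector k F) u ≡ just r → u ≡ r ∷ʳ k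
selectD-sound k F u select with lastSplit u in split
... | just (v , z) with if-just⁻ (z ≡ᵇ k) select
...   | z≡ᵇk , refl rewrite ≡ᵇ⇒≡ z k z≡ᵇk = lastSplit-sound u split

sliceD⁺ : ∀ {k F r} → (r ∷ʳ k) ∈ F → r ∈ sliceD k F
sliceD⁺ {k} {F} {r} r∷k∈F = ∈-mapMaybe⁺ (proj₁ (sliceD-selector k F)) r∷k∈F (selectD-∷ʳ k F r)

sliceD⁻ : ∀ {k F r} → r ∈ sliceD k F → (r ∷ʳ k) ∈ F
sliceD⁻ {k} {F} r∈ with ∈-mapMaybe⁻ (proj₁ (sliceD-selector k F)) r∈
... | u , u∈F , select = subst (_∈ F) (selectD-sound k F u select) u∈F

RightStable : ℕ → List (List ℕ) → Set
RightStable e G = ∀ {û ŵ k} → (û ∷ʳ k) ∈ G → IsSetGT 0 e ŵ → ŵ ≤B û → (ŵ ∷ʳ k) ∈ G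

LeftStable : ℕ → List (List ℕ) → Set
LeftStable e G = ∀ {h û ŵ} → (h ∷ û) ∈ G → IsSetGT h e ŵ → ŵ ≤B û → (h ∷ ŵ) ∈ G

init-set : ∀ {k e w x} → IsSetGT k (suc e) (w ∷ʳ x) → IsSetGT k e w
init-set {w = w} {x} (len , sorted , above) =
  suc-injective (trans (sym (+-comm (length w) 1)) (trans (sym (length-++ w)) len)) ,
  ⊆-sorted (++⁺ʳ [ x ] ⊆-refl) sorted ,
  ++⁻ˡ w above

tail-set : ∀ {k e x w} → IsSetGT k (suc e) (x ∷ w) → IsSetGT x e w
tail-set (len , sorted , _) = suc-injective len , Linked.tail sorted , sorted-head sorted

Pointwise-∷ʳ⁻ : ∀ {A B : Set} {R : A → B → Set} v {x u} → Pointwise R (v ∷ʳ x) u →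
                ∃₂ λ u' y → u ≡ u' ∷ʳ y × Pointwise R v u' × R x y
Pointwise-∷ʳ⁻ [] (xRy P∷ P[]) = [] , _ , refl , P[] , xRy
Pointwise-∷ʳ⁻ (v ∷ vs) (vRu P∷ rest) with Pointwise-∷ʳ⁻ vs rest
... | u' , y , refl , vs≤u' , xRy = _ ∷ u' , y , refl , vRu P∷ vs≤u' , xRy

-- To lower u = u' ∪ {u_d} to v = {v_1} ∪ v'' ∪ {v_d}, first lower u' to
-- {v_1} ∪ v'' keeping u_d (right stability), then lower v'' ∪ {u_d} to
-- v'' ∪ {v_d} keeping v_1 (left stability).
stable⇒shifted : ∀ {d G} → 2 ≤ d → RightStable (d ∸ 1) G → LeftStable (d ∸ 1) G → Shifted d G
stable⇒shifted (s≤s (s≤s z≤n)) right left u v u∈G v-set v≤u with initLast v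
... | [] with () ← proj₁ v-set
... | v' ∷ʳ′ vd with Pointwise-∷ʳ⁻ v' v≤u
...   | u' , ud , refl , v'≤u' , vd≤ud with v'
...     | [] with () ← proj₁ v-set
...     | v₁ ∷ v'' = left (right u∈G (init-set v-set) v'≤u') (tail-set v-set)
                          (Pointwise.++⁺ (Pointwise.refl ≤-refl) (vd≤ud P∷ P[]))

-- Left-compressed families are left-stable: each slice \hat F_{1,h} is down-closed.
leftCompressed⇒stable : ∀ {d F} → FiniteFamily d F → LeftCompressed d F → LeftStable (d ∸ 1) F
leftCompressed⇒stable (sets , _) compressed {h} h∷û∈F ŵ-set ŵ≤û with All.lookup sets h∷û∈F
... | _ , _ , 0<h ∷ _ = slice1⁻ (compressed⇒downClosed (compressed h 0<h) (slice1⁺ h∷û∈F) ŵ-set ŵ≤û)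

-- Right-compressed families are right-stable: each slice \hat F_{d,k} is down-closed.
rightCompressed⇒stable : ∀ {d F} → FiniteFamily d F → RightCompressed d F → RightStable (d ∸ 1) F
rightCompressed⇒stable (sets , _) compressed {û} {k = k} û∷k∈F ŵ-set ŵ≤û =
  sliceD⁻ (compressed⇒downClosed (compressed k 0<k) (sliceD⁺ û∷k∈F) ŵ-set ŵ≤û)
  where
  0<k : 0 < k
  0<k = All.lookup (proj₂ (proj₂ (All.lookup sets û∷k∈F))) (∈-++⁺ʳ û (here refl))

∈-glue⁻ : ∀ (f : ℕ → List ℕ → List ℕ) (S : ℕ → List (List ℕ)) {K w} →
          w ∈ concatMap (λ k → map (f k) (S k)) K → ∃₂ λ k r → k ∈ K × r ∈ S k × w ≡ f k r
∈-glue⁻ f S w∈ with find (∈-concatMap⁻ (λ k → map (f k) (S k)) w∈)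
... | k , k∈K , w∈k with ∈-map⁻ (f k) w∈k
...   | r , r∈S , refl = k , r , k∈K , r∈S , refl

∈-glue⁺ : ∀ (f : ℕ → List ℕ → List ℕ) (S : ℕ → List (List ℕ)) {K k r} →
          k ∈ K → r ∈ S k → f k r ∈ concatMap (λ k → map (f k) (S k)) K
∈-glue⁺ f S k∈K r∈S = ∈-concatMap⁺ (λ k → map (f k) (S k)) (lose k∈K (∈-map⁺ (f _) r∈S))

≈F-sym : ∀ {F G} → F ≈F G → G ≈F F
≈F-sym F≈G u = ⇔.sym (F≈G u)

CL-leftStable : ∀ d {G} X → G ≈F CL d X → LeftStable (d ∸ 1) G
CL-leftStable d X G≈CL h∷û∈G ŵ-set ŵ≤û
  with ∈-glue⁻ _∷_ (λ k → CGT k (d ∸ 1) (slice1 k X)) {K = interval 1 (maxF X)} (to (G≈CL _) h∷û∈G)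
... | k , r , k∈K , r∈S , refl =
  from (G≈CL _) (∈-glue⁺ _∷_ (λ k → CGT k (d ∸ 1) (slice1 k X)) k∈K
                  (CGT-downClosed k (d ∸ 1) (slice1 k X) r∈S ŵ-set ŵ≤û))

CR-rightStable : ∀ d {G} X → G ≈F CR d X → RightStable (d ∸ 1) G
CR-rightStable d X G≈CR {û} û∷k∈G ŵ-set ŵ≤û
  with ∈-glue⁻ (λ k r → r ∷ʳ k) (λ k → CGT 0 (d ∸ 1) (sliceD k X)) {K = interval 1 (maxF X)} (to (G≈CR _) û∷k∈G)
... | k , r , k∈K , r∈S , eq with ∷ʳ-injective û r eq
...   | refl , refl =
  from (G≈CR _) (∈-glue⁺ (λ k r → r ∷ʳ k) (λ k → CGT 0 (d ∸ 1) (sliceD k X)) k∈K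
                  (CGT-downClosed 0 (d ∸ 1) (sliceD k X) r∈S ŵ-set ŵ≤û))

consecutive-steps : ∀ d F n →
  (iterC d F (suc n) ≡ CL d (iterC d F n) × iterC d F (suc (suc n)) ≡ CR d (iterC d F (suc n))) ⊎
  (iterC d F (suc n) ≡ CR d (iterC d F n) × iterC d F (suc (suc n)) ≡ CL d (iterC d F (suc n)))
consecutive-steps d F n with isEven n
... | true = inj₁ (refl , refl)
... | false = inj₂ (refl , refl)

constant⇒next-two : ∀ d F n → ((m : ℕ) → n ≤ m → iterC d F m ≈F iterC d F n) →
                    iterC d F n ≈F iterC d F (suc n) × iterC d F n ≈F iterC d F (suc (suc n))
constant⇒next-two d F n constant =
  ≈F-sym (constant (suc n) (n≤1+n n)) , ≈F-sym (constant (suc (suc n)) (m≤n⇒m≤1+n (n≤1+n n)))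

limit-is-fixpoint : ∀ d F n → ((m : ℕ) → n ≤ m → iterC d F m ≈F iterC d F n) →
                    ∃₂ λ X Y → iterC d F n ≈F CL d X × iterC d F n ≈F CR d Y
limit-is-fixpoint d F n constant with constant⇒next-two d F n constant | consecutive-steps d F n
... | next , next² | inj₁ (left , right) =
  iterC d F n , iterC d F (suc n) , subst (iterC d F n ≈F_) left next , subst (iterC d F n ≈F_) right next²
... | next , next² | inj₂ (right , left) =
  iterC d F (suc n) , iterC d F n , subst (iterC d F n ≈F_) left next² , subst (iterC d F n ≈F_) right next

lemma3p9 : (d : ℕ) → 2 ≤ d → (F : List (List ℕ)) → FiniteFamily d F →
    (LeftCompressed d F → RightCompressed d F → Shifted d F)
    × ((n : ℕ) → ((m : ℕ) → n ≤ m → iterC d F m ≈F iterC d F n) → Shifted d (iterC d F n))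
lemma3p9 d 2≤d F family = compressed⇒shifted , limit⇒shifted
  where
  compressed⇒shifted : LeftCompressed d F → RightCompressed d F → Shifted d F
  compressed⇒shifted left right =
    stable⇒shifted 2≤d (rightCompressed⇒stable family right) (leftCompressed⇒stable family left)

  limit⇒shifted : (n : ℕ) → ((m : ℕ) → n ≤ m → iterC d F m ≈F iterC d F n) → Shifted d (iterC d F n)
  limit⇒shifted n constant with limit-is-fixpoint d F n constant
  ... | X , Y , ≈CL , ≈CR = stable⇒shifted 2≤d (CR-rightStable d Y ≈CR) (CL-leftStable d X ≈CL)
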